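{- Let $k\geq 1$ and let $\tau\in S_k(123,231)$ with $\tau\neq(k,k-1,\dots,1)$. For $n\geq 0$ let $b_\tau(n)=|S_n(123,231,\tau)|$. Then either there exists $r$ with $1\leq r\leq k-1$ such that $\tau=(r,r-1,\dots,2,1,k,k-1,\dots,r+1)$, and in that case $$b_\tau(n)=(k-2)n-\frac{k(k-3)}{2}\quad\text{for all } n\geq k;$$ or $\tau=(k,\tau')$ for some $\tau'\in S_{k-1}(123,231)$ (i.e. $\tau_1=k$ and $(\tau_2,\dots,\tau_k)$, a permutation of $\{1,\dots,k-1\}$, avoids $123$ and $231$), and in that case $$b_\tau(n)=b_{\tau'}(n-1)+n-1\quad\text{for all } n\geq k.$$
   Context: Permutations are written in one-line notation $\tau=(\tau_1,\dots,\tau_k)$; $S_k$ is the set of permutations of $\{1,\dots,k\}$. A permutation $\alpha\in S_n$ contains a pattern $\beta\in S_j$ if there are indices $i_1<\dots<i_j$ such that $(\alpha_{i_1},\dots,\alpha_{i_j})$ is order-isomorphic to $\beta$ (i.e. $\alpha_{i_a}<\alpha_{i_b}$ iff $\beta_a<\beta_b$); otherwise $\alpha$ avoids $\beta$. For a set of patterns, $S_n(\beta^1,\dots,\beta^s)$ denotes the set of permutations in $S_n$ avoiding all of $\beta^1,\dots,\beta^s$; $S_0$ consists of the empty permutation. -}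

module Defs where

open import Data.Bool using (Bool; true; false; _∧_; not; T)
open import Data.Nat using (ℕ; zero; suc; _+_; _∸_; _<ᵇ_; _≡ᵇ_)
open import Data.List using (List; []; _∷_; _++_; map; concatMap; length; filterᵇ; upTo; zip)
open import Data.Bool.ListAction using (all; any)
open import Data.Product using (_×_; _,_; proj₁; proj₂)

_==_ : Bool → Bool → Bool
true  == true  = true
false == false = true
_     == _     = false

-- A permutation in one-line notation is a list of naturals.
-- The values 1..n in increasing order.
oneTo : ℕ → List ℕ
oneTo n = map suc (upTo n)

isPermᵇ : ℕ → List ℕ → Bool
isPermᵇ n w = (length w ≡ᵇ n) ∧ all (λ v → any (λ x → x ≡ᵇ v) w) (oneTo n)

words : ℕ → ℕ → List (List ℕ)
words zero    m = [] ∷ []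
words (suc n) m = concatMap (λ w → map (λ v → v ∷ w) (oneTo m)) (words n m)

perms : ℕ → List (List ℕ)
perms n = filterᵇ (isPermᵇ n) (words n n)

subseqs : ℕ → List ℕ → List (List ℕ)
subseqs zero    xs       = [] ∷ []
subseqs (suc j) []       = []
subseqs (suc j) (x ∷ xs) = map (x ∷_) (subseqs j xs) ++ subseqs (suc j) xs

orderIsoᵇ : List ℕ → List ℕ → Bool
orderIsoᵇ s t = (length s ≡ᵇ length t) ∧
  all (λ p → all (λ q → (proj₁ p <ᵇ proj₁ q) == (proj₂ p <ᵇ proj₂ q)) ps) ps
  where ps = zip s t

containsᵇ : List ℕ → List ℕ → Bool
containsᵇ α β = any (λ s → orderIsoᵇ s β) (subseqs (length β) α)

avoidsᵇ : List ℕ → List ℕ → Bool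
avoidsᵇ α β = not (containsᵇ α β)

p123 : List ℕ
p123 = 1 ∷ 2 ∷ 3 ∷ []

p231 : List ℕ
p231 = 2 ∷ 3 ∷ 1 ∷ []

InS123-231 : ℕ → List ℕ → Set
InS123-231 k τ = T (isPermᵇ k τ) × T (avoidsᵇ τ p123) × T (avoidsᵇ τ p231)

b : List ℕ → ℕ → ℕ
b τ n = length (filterᵇ (λ α → avoidsᵇ α p123 ∧ avoidsᵇ α p231 ∧ avoidsᵇ α τ) (perms n))

desc : ℕ → ℕ → List ℕ
desc lo zero    = []
desc lo (suc m) = (lo + suc m) ∷ desc lo m

-- A permutation avoiding 123 and 231 either begins with its maximum n or is layered,
-- (s, s-1, ..., 1, n, n-1, ..., s+1): the entries before n decrease (else 123), lie below the
-- entries after n (else 231), and the entries after n decrease (else 123 with the first entry).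
-- So S_{n+1}(123,231) consists of (n+1, α) for α in S_n(123,231), and the n layered
-- permutations whose first layer has size 1, ..., n.
--
-- If τ = (k, τ'), a leading maximum of the pattern must be matched by a leading maximum, so
-- (n+1, α) avoids τ iff α avoids τ'; and a pattern beginning with its maximum occurs in a layered
-- permutation only if it is decreasing, so every layered permutation avoids τ ≠ (k, ..., 1).
-- Hence b_τ(n+1) = b_τ'(n) + n.
--
-- If τ is layered with layers r and k - r, then (n+1, α) avoids τ iff α does, because the first
-- entry of τ is not its maximum; and the layered permutation with layers s and n+1-s contains τ
-- iff r ≤ s and k - r ≤ n+1-s, which for n ≥ k-1 leaves k - 2 avoiders. Hence
-- b_τ(n+1) = b_τ(n) + k - 2 for n ≥ k-1, and b_τ(k-1) = |S_{k-1}(123,231)| = (k-1)(k-2)/2 + 1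
-- fixes the constant.

module Submission where

open import Defs
open import Data.Bool using (Bool; true; false; _∧_; T; if_then_else_)
open import Data.Bool.Properties using (T-≡; T-∧)
open import Data.Empty using (⊥; ⊥-elim)
open import Data.Unit using (⊤; tt)
open import Data.Nat using (ℕ; zero; suc; _+_; _∸_; _<ᵇ_; _≤_; _<_; _>_; z≤n; s≤s; z<s)
open import Data.Nat.Properties
open import Data.Nat.Tactic.RingSolver using (solve-∀)
open import Data.Integer using (ℤ; +_; _-_; _*_)
import Data.Integer as ℤ
import Data.Integer.Properties as ℤ
import Data.Integer.Tactic.RingSolver as ℤ
open import Data.Product using (Σ; ∃; _×_; _,_; proj₁; proj₂)
open import Data.Sum using (_⊎_; inj₁; inj₂)
open import Data.List using (List; []; _∷_; _++_; map; length; filterᵇ; zip; head)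
open import Data.Maybe using (just)
open import Data.Maybe.Properties using (just-injective)
open import Data.List.Properties
  using (++-identityʳ; length-++; length-map; map-++; map-∘; ∷-injective; filter-++; filter-all; filter-none)
open import Data.List.Relation.Unary.All as All using (All; []; _∷_)
import Data.List.Relation.Unary.All.Properties as AllP
open import Data.List.Relation.Unary.Any as Any using (here; there)
import Data.List.Relation.Unary.Any.Properties as AnyP
open import Data.List.Relation.Unary.AllPairs as AllPairs using (AllPairs; []; _∷_)
import Data.List.Relation.Unary.AllPairs.Properties as AllPairsP
open import Data.List.Relation.Unary.Unique.Propositional using (Unique)
import Data.List.Relation.Unary.Unique.Propositional.Properties as UniqueP
open import Data.List.Membership.Propositional using (_∈_; _∉_; find; lose)
open import Data.List.Membership.DecPropositional _≟_ using (_∈?_)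
open import Data.List.Membership.Propositional.Properties
open import Data.List.Relation.Binary.Sublist.Propositional
  using (_⊆_; []; _∷_; _∷ʳ_; minimum; ⊆-refl; ⊆-trans; from∈; lookup)
open import Data.List.Relation.Binary.Sublist.Propositional.Properties
  using (++⁺; ++⁺ˡ; ++⁺ʳ; length-mono-≤; All-resp-⊆; ∷ˡ⁻)
open import Function.Base using (_∘_)
open import Function.Bundles using (Equivalence)
open import Relation.Nullary using (¬_; yes; no)
open import Relation.Nullary.Decidable using (T?)
open import Relation.Binary.PropositionalEquality

AllPairs-resp-⊆ : ∀ {A : Set} {R : A → A → Set} {xs ys : List A} → xs ⊆ ys → AllPairs R ys → AllPairs R xs
AllPairs-resp-⊆ []         []       = []
AllPairs-resp-⊆ (_ ∷ʳ p)   (_ ∷ rs) = AllPairs-resp-⊆ p rs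
AllPairs-resp-⊆ (refl ∷ p) (r ∷ rs) = All-resp-⊆ p r ∷ AllPairs-resp-⊆ p rs

⊆-++-split : ∀ {A : Set} (xs : List A) {ys u} → u ⊆ xs ++ ys →
             ∃ λ u₁ → ∃ λ u₂ → u ≡ u₁ ++ u₂ × u₁ ⊆ xs × u₂ ⊆ ys
⊆-++-split []       u⊆ys = [] , _ , refl , [] , u⊆ys
⊆-++-split (x ∷ xs) (.x ∷ʳ u⊆) with ⊆-++-split xs u⊆
... | u₁ , u₂ , refl , u₁⊆ , u₂⊆ = u₁ , u₂ , refl , x ∷ʳ u₁⊆ , u₂⊆
⊆-++-split (x ∷ xs) (refl ∷ u⊆) with ⊆-++-split xs u⊆
... | u₁ , u₂ , refl , u₁⊆ , u₂⊆ = x ∷ u₁ , u₂ , refl , refl ∷ u₁⊆ , u₂⊆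

Unique-pair : ∀ {A : Set} {a b : A} {xs} → Unique xs → (a ∷ b ∷ []) ⊆ xs → a ≢ b
Unique-pair u ab⊆ with AllPairs-resp-⊆ ab⊆ u
... | (a≢b ∷ []) ∷ _ = a≢b

∈-remove : ∀ {A : Set} {x : A} xs → x ∈ xs →
           ∃ λ xs' → length xs ≡ suc (length xs') × (∀ {z} → z ∈ xs → z ≢ x → z ∈ xs')
∈-remove (y ∷ xs) (here refl) = xs , refl , λ { (here refl) z≢x → ⊥-elim (z≢x refl) ; (there z∈) _ → z∈ }
∈-remove (y ∷ xs) (there x∈) with ∈-remove xs x∈
... | xs' , len , keep =
  y ∷ xs' , cong suc len , λ { (here refl) _ → here refl ; (there z∈) z≢x → there (keep z∈ z≢x) }

unique⇒length-≤ : ∀ {A : Set} (xs ys : List A) → Unique xs → (∀ {z} → z ∈ xs → z ∈ ys) →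
                  length xs ≤ length ys
unique⇒length-≤ []       ys _            _     = z≤n
unique⇒length-≤ (x ∷ xs) ys (x∉xs ∷ u) xs⊆ys with ∈-remove ys (xs⊆ys (here refl))
... | ys' , len , keep = subst (suc (length xs) ≤_) (sym len)
  (s≤s (unique⇒length-≤ xs ys' u (λ z∈ → keep (xs⊆ys (there z∈)) (λ z≡x → All.lookup x∉xs z∈ (sym z≡x)))))

unique-same-members⇒length≡ : ∀ {A : Set} (xs ys : List A) → Unique xs → Unique ys →
  (∀ {z} → z ∈ xs → z ∈ ys) → (∀ {z} → z ∈ ys → z ∈ xs) → length xs ≡ length ys
unique-same-members⇒length≡ xs ys uxs uys xs⊆ys ys⊆xs =
  ≤-antisym (unique⇒length-≤ xs ys uxs xs⊆ys) (unique⇒length-≤ ys xs uys ys⊆xs)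

Unique-from-splits : ∀ {A : Set} (w : List A) → (∀ pre x post → w ≡ pre ++ x ∷ post → x ∉ post) → Unique w
Unique-from-splits []      _       = []
Unique-from-splits (x ∷ w) no-dup =
  All.tabulate (λ y∈ x≡y → no-dup [] x w refl (subst (_∈ w) (sym x≡y) y∈)) ∷
  Unique-from-splits w (λ pre y post eq → no-dup (x ∷ pre) y post (cong (x ∷_) eq))

count : ∀ {A : Set} → (A → Bool) → List A → ℕ
count p xs = length (filterᵇ p xs)

module _ {A : Set} (p : A → Bool) where

  count-++ : ∀ xs ys → count p (xs ++ ys) ≡ count p xs + count p ys
  count-++ xs ys = trans (cong length (filter-++ (T? ∘ p) xs ys)) (length-++ (filterᵇ p xs))

  count-all : ∀ {xs} → All (T ∘ p) xs → count p xs ≡ length xs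
  count-all all-p = cong length (filter-all (T? ∘ p) all-p)

  count-none : ∀ {xs} → All (¬_ ∘ T ∘ p) xs → count p xs ≡ 0
  count-none no-p = cong length (filter-none (T? ∘ p) no-p)

  count-cong : ∀ (q : A → Bool) xs → (∀ {x} → x ∈ xs → p x ≡ q x) → count p xs ≡ count q xs
  count-cong q []       _    = refl
  count-cong q (x ∷ xs) p≗q with p x | q x | p≗q (here refl)
  ... | true  | true  | _ = cong suc (count-cong q xs (p≗q ∘ there))
  ... | false | false | _ = count-cong q xs (p≗q ∘ there)

count-map : ∀ {A B : Set} (p : B → Bool) (f : A → B) xs → count p (map f xs) ≡ count (p ∘ f) xs
count-map p f []       = refl
count-map p f (x ∷ xs) with p (f x)
... | true  = cong suc (count-map p f xs)
... | false = count-map p f xs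

==⇒≡ : ∀ {a b} → T (a == b) → a ≡ b
==⇒≡ {true}  {true}  _ = refl
==⇒≡ {false} {false} _ = refl

≡⇒== : ∀ {a b} → a ≡ b → T (a == b)
≡⇒== {true}  refl = tt
≡⇒== {false} refl = tt

<ᵇ-true : ∀ {m n} → m < n → (m <ᵇ n) ≡ true
<ᵇ-true m<n = Equivalence.to T-≡ (<⇒<ᵇ m<n)

<ᵇ-true⁻ : ∀ {m n} → (m <ᵇ n) ≡ true → m < n
<ᵇ-true⁻ {m} {n} eq = <ᵇ⇒< m n (subst T (sym eq) tt)

<ᵇ-false : ∀ {m n} → n ≤ m → (m <ᵇ n) ≡ false
<ᵇ-false {m} {n} n≤m with m <ᵇ n in eq
... | false = refl
... | true  = ⊥-elim (<⇒≱ (<ᵇ-true⁻ eq) n≤m)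

<ᵇ-false⁻ : ∀ {m n} → (m <ᵇ n) ≡ false → n ≤ m
<ᵇ-false⁻ {m} {n} eq = ≮⇒≥ (λ m<n → subst T eq (<⇒<ᵇ m<n))

<ᵇ-cong : ∀ {m n m' n'} → (m < n → m' < n') → (m' < n' → m < n) → (m <ᵇ n) ≡ (m' <ᵇ n')
<ᵇ-cong {m} {n} to from with m <? n
... | yes m<n = trans (<ᵇ-true m<n) (sym (<ᵇ-true (to m<n)))
... | no  m≮n = trans (<ᵇ-false (≮⇒≥ m≮n)) (sym (<ᵇ-false (≮⇒≥ (m≮n ∘ from))))

<ᵇ-transport : ∀ {m n m' n'} → (m <ᵇ n) ≡ (m' <ᵇ n') → m < n → m' < n'
<ᵇ-transport {m} {n} {m'} {n'} eq m<n = <ᵇ⇒< m' n' (subst T eq (<⇒<ᵇ m<n))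

-- Pattern containment

SameOrder : ℕ × ℕ → ℕ × ℕ → Set
SameOrder (x , y) (u , v) = (x <ᵇ u) ≡ (y <ᵇ v) × (u <ᵇ x) ≡ (v <ᵇ y)

OrderIso : List ℕ → List ℕ → Set
OrderIso []      []      = ⊤
OrderIso []      (_ ∷ _) = ⊥
OrderIso (_ ∷ _) []      = ⊥
OrderIso (x ∷ s) (y ∷ t) = All (SameOrder (x , y)) (zip s t) × OrderIso s t

OrderIso⇒length≡ : ∀ s t → OrderIso s t → length s ≡ length t
OrderIso⇒length≡ []      []      _       = refl
OrderIso⇒length≡ (x ∷ s) (y ∷ t) (_ , o) = cong suc (OrderIso⇒length≡ s t o)

agreeᵇ : ℕ × ℕ → ℕ × ℕ → Bool
agreeᵇ p q = (proj₁ p <ᵇ proj₁ q) == (proj₂ p <ᵇ proj₂ q)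

PairwiseAgree : List (ℕ × ℕ) → Set
PairwiseAgree ps = All (λ p → All (T ∘ agreeᵇ p) ps) ps

PairwiseAgree⇒OrderIso : ∀ s t → length s ≡ length t → PairwiseAgree (zip s t) → OrderIso s t
PairwiseAgree⇒OrderIso []      []      _  _ = tt
PairwiseAgree⇒OrderIso (x ∷ s) (y ∷ t) eq ((_ ∷ row) ∷ rows) =
  All.zipWith sameOrder (row , All.map headAgrees rows) ,
  PairwiseAgree⇒OrderIso s t (suc-injective eq) (All.map All.tail rows)
  where
  headAgrees : ∀ {p} → All (T ∘ agreeᵇ p) ((x , y) ∷ zip s t) → T (agreeᵇ p (x , y))
  headAgrees (h ∷ _) = h
  sameOrder : ∀ {q} → T (agreeᵇ (x , y) q) × T (agreeᵇ q (x , y)) → SameOrder (x , y) q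
  sameOrder (xy<q , q<xy) = ==⇒≡ xy<q , ==⇒≡ q<xy

OrderIso⇒PairwiseAgree : ∀ s t → OrderIso s t → PairwiseAgree (zip s t)
OrderIso⇒PairwiseAgree []      []      _       = []
OrderIso⇒PairwiseAgree (x ∷ s) (y ∷ t) (r , o) =
  (≡⇒== (trans (<ᵇ-false {x} ≤-refl) (sym (<ᵇ-false {y} ≤-refl))) ∷ All.map (≡⇒== ∘ proj₁) r) ∷
  All.zipWith (λ (h , row) → h ∷ row) (All.map (≡⇒== ∘ proj₂) r , OrderIso⇒PairwiseAgree s t o)

orderIsoᵇ-sound : ∀ s t → T (orderIsoᵇ s t) → OrderIso s t
orderIsoᵇ-sound s t iso with Equivalence.to T-∧ iso
... | len≡ , agree = PairwiseAgree⇒OrderIso s t (≡ᵇ⇒≡ (length s) (length t) len≡)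
  (All.map (AllP.all⁺ _ _) (AllP.all⁺ _ (zip s t) agree))

orderIsoᵇ-complete : ∀ s t → OrderIso s t → T (orderIsoᵇ s t)
orderIsoᵇ-complete s t o = Equivalence.from T-∧
  (≡⇒≡ᵇ _ _ (OrderIso⇒length≡ s t o) ,
   AllP.all⁻ _ (All.map (AllP.all⁻ _) (OrderIso⇒PairwiseAgree s t o)))

Contains : List ℕ → List ℕ → Set
Contains α β = ∃ λ s → s ⊆ α × OrderIso s β

∈-subseqs⁻ : ∀ j α {s} → s ∈ subseqs j α → s ⊆ α
∈-subseqs⁻ zero    α        (here refl) = minimum α
∈-subseqs⁻ (suc j) (x ∷ xs) s∈ with ∈-++⁻ (map (x ∷_) (subseqs j xs)) s∈
... | inj₁ s∈kept with ∈-map⁻ (x ∷_) s∈kept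
...   | s' , s'∈ , refl = refl ∷ ∈-subseqs⁻ j xs s'∈
∈-subseqs⁻ (suc j) (x ∷ xs) s∈ | inj₂ s∈skipped = x ∷ʳ ∈-subseqs⁻ (suc j) xs s∈skipped

∈-subseqs⁺ : ∀ {s α} → s ⊆ α → s ∈ subseqs (length s) α
∈-subseqs⁺ []                   = here refl
∈-subseqs⁺ {[]}    (y ∷ʳ _)     = here refl
∈-subseqs⁺ {_ ∷ s} (y ∷ʳ s⊆α)   = ∈-++⁺ʳ (map (y ∷_) (subseqs (length s) _)) (∈-subseqs⁺ s⊆α)
∈-subseqs⁺         (refl ∷ s⊆α) = ∈-++⁺ˡ (∈-map⁺ (_ ∷_) (∈-subseqs⁺ s⊆α))

containsᵇ-sound : ∀ α β → T (containsᵇ α β) → Contains α β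
containsᵇ-sound α β c with find (AnyP.any⁻ _ (subseqs (length β) α) c)
... | s , s∈ , iso = s , ∈-subseqs⁻ (length β) α s∈ , orderIsoᵇ-sound s β iso

containsᵇ-complete : ∀ α β → Contains α β → T (containsᵇ α β)
containsᵇ-complete α β (s , s⊆α , o) = AnyP.any⁺ _
  (lose (subst (λ j → s ∈ subseqs j α) (OrderIso⇒length≡ s β o) (∈-subseqs⁺ s⊆α)) (orderIsoᵇ-complete s β o))

avoidsᵇ-sound : ∀ α β → T (avoidsᵇ α β) → ¬ Contains α β
avoidsᵇ-sound α β av c with containsᵇ α β | containsᵇ-complete α β c
... | true | _ = av

avoidsᵇ-complete : ∀ α β → ¬ Contains α β → T (avoidsᵇ α β)
avoidsᵇ-complete α β ¬c with containsᵇ α β in eq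
... | false = tt
... | true  = ¬c (containsᵇ-sound α β (subst T (sym eq) tt))

avoidsᵇ-cong : ∀ α β γ δ → (Contains α β → Contains γ δ) → (Contains γ δ → Contains α β) →
               avoidsᵇ α β ≡ avoidsᵇ γ δ
avoidsᵇ-cong α β γ δ to from with containsᵇ α β in e₁ | containsᵇ γ δ in e₂
... | true  | true  = refl
... | false | false = refl
... | true  | false = ⊥-elim (subst T e₂ (containsᵇ-complete γ δ (to (containsᵇ-sound α β (subst T (sym e₁) tt)))))
... | false | true  = ⊥-elim (subst T e₁ (containsᵇ-complete α β (from (containsᵇ-sound γ δ (subst T (sym e₂) tt)))))

avoiding : List ℕ → List ℕ → Bool
avoiding β α = avoidsᵇ α β

OrderIso-map : ∀ (f : ℕ → ℕ) → (∀ a b → (f a <ᵇ f b) ≡ (a <ᵇ b)) → ∀ t → OrderIso (map f t) t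
OrderIso-map f mono []      = tt
OrderIso-map f mono (x ∷ t) = row t , OrderIso-map f mono t
  where
  row : ∀ t → All (SameOrder (f x , x)) (zip (map f t) t)
  row []      = []
  row (a ∷ t) = (mono x a , mono a x) ∷ row t

SameOrder-below : ∀ {x y} s t → length s ≡ length t → All (SameOrder (x , y)) (zip s t) →
                  All (_< x) s → All (_< y) t
SameOrder-below []      []      _  _              _           = []
SameOrder-below (u ∷ s) (v ∷ t) eq ((_ , e) ∷ r) (u<x ∷ a) =
  <ᵇ-transport e u<x ∷ SameOrder-below s t (suc-injective eq) r a

SameOrder-below⁻ : ∀ {x y} s t → length s ≡ length t → All (SameOrder (x , y)) (zip s t) →
                   All (_< y) t → All (_< x) s
SameOrder-below⁻ []      []      _  _              _           = []
SameOrder-below⁻ (u ∷ s) (v ∷ t) eq ((_ , e) ∷ r) (v<y ∷ a) =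
  <ᵇ-transport (sym e) v<y ∷ SameOrder-below⁻ s t (suc-injective eq) r a

OrderIso-maxHead : ∀ {x y} s t → OrderIso (x ∷ s) (y ∷ t) → All (_< x) s → All (_< y) t
OrderIso-maxHead s t (r , o) = SameOrder-below s t (OrderIso⇒length≡ s t o) r

OrderIso-maxHead⁻ : ∀ {x y} s t → OrderIso (x ∷ s) (y ∷ t) → All (_< y) t → All (_< x) s
OrderIso-maxHead⁻ s t (r , o) = SameOrder-below⁻ s t (OrderIso⇒length≡ s t o) r

Contains-resp-⊆ : ∀ {α α' β} → α ⊆ α' → Contains α β → Contains α' β
Contains-resp-⊆ α⊆α' (s , s⊆α , o) = s , ⊆-trans s⊆α α⊆α' , o

¬Contains-longer : ∀ α β → length α < length β → ¬ Contains α β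
¬Contains-longer α β lt (s , s⊆α , o) =
  <⇒≱ lt (subst (_≤ length α) (OrderIso⇒length≡ s β o) (length-mono-≤ s⊆α))

Contains-∷⁻ : ∀ x α y β → Contains (x ∷ α) (y ∷ β) → Contains α β
Contains-∷⁻ x α y β (_ ∷ s , _ ∷ʳ s⊆α , (_ , o))  = s , ∷ˡ⁻ s⊆α , o
Contains-∷⁻ x α y β (_ ∷ s , refl ∷ s⊆α , (_ , o)) = s , s⊆α , o

Contains-∷⁺ : ∀ x α y β → All (_< x) α → All (_< y) β → Contains α β → Contains (x ∷ α) (y ∷ β)
Contains-∷⁺ x α y β α<x β<y (s , s⊆α , o) =
  x ∷ s , refl ∷ s⊆α , row s β (OrderIso⇒length≡ s β o) (All-resp-⊆ s⊆α α<x) β<y , o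
  where
  row : ∀ s t → length s ≡ length t → All (_< x) s → All (_< y) t → All (SameOrder (x , y)) (zip s t)
  row []      []      _  _           _           = []
  row (u ∷ s) (v ∷ t) eq (u<x ∷ s<x) (v<y ∷ t<y) =
    (trans (<ᵇ-false (<⇒≤ u<x)) (sym (<ᵇ-false (<⇒≤ v<y))) , trans (<ᵇ-true u<x) (sym (<ᵇ-true v<y))) ∷
    row s t (suc-injective eq) s<x t<y

Contains-max∷⁻ : ∀ x α y β {v} → All (_< x) α → v ∈ β → y < v →
                 Contains (x ∷ α) (y ∷ β) → Contains α (y ∷ β)
Contains-max∷⁻ x α y β α<x v∈β y<v (s , _ ∷ʳ s⊆α , o)        = s , s⊆α , o
Contains-max∷⁻ x α y β α<x v∈β y<v (_ ∷ s , refl ∷ s⊆α , o) =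
  ⊥-elim (<-asym y<v (All.lookup (OrderIso-maxHead s β o (All-resp-⊆ s⊆α α<x)) v∈β))

Contains-123⁺ : ∀ {a b c α} → (a ∷ b ∷ c ∷ []) ⊆ α → a < b → b < c → Contains α p123
Contains-123⁺ {a} {b} {c} abc⊆α a<b b<c = _ , abc⊆α ,
  ((<ᵇ-true a<b , <ᵇ-false (<⇒≤ a<b)) ∷ (<ᵇ-true a<c , <ᵇ-false (<⇒≤ a<c)) ∷ []) ,
  ((<ᵇ-true b<c , <ᵇ-false (<⇒≤ b<c)) ∷ []) , [] , tt
  where
  a<c = <-trans a<b b<c

Contains-231⁺ : ∀ {a b c α} → (a ∷ b ∷ c ∷ []) ⊆ α → a < b → c < a → Contains α p231
Contains-231⁺ {a} {b} {c} abc⊆α a<b c<a = _ , abc⊆α ,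
  ((<ᵇ-true a<b , <ᵇ-false (<⇒≤ a<b)) ∷ (<ᵇ-false (<⇒≤ c<a) , <ᵇ-true c<a) ∷ []) ,
  ((<ᵇ-false (<⇒≤ c<b) , <ᵇ-true c<b) ∷ []) , [] , tt
  where
  c<b = <-trans c<a a<b

Decreasing : List ℕ → Set
Decreasing = AllPairs _>_

Decreasing⇒Unique : ∀ {xs} → Decreasing xs → Unique xs
Decreasing⇒Unique = AllPairs.map (λ y<x x≡y → <-irrefl (sym x≡y) y<x)

pairs⇒Decreasing : ∀ xs → (∀ {a b} → (a ∷ b ∷ []) ⊆ xs → b < a) → Decreasing xs
pairs⇒Decreasing []       _        = []
pairs⇒Decreasing (x ∷ xs) pair-dec =
  All.tabulate (λ y∈ → pair-dec (refl ∷ from∈ y∈)) ∷ pairs⇒Decreasing xs (pair-dec ∘ (x ∷ʳ_))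

OrderIso-decreasing : ∀ s t → OrderIso s t → Decreasing s → Decreasing t
OrderIso-decreasing []      []      _ _        = []
OrderIso-decreasing (x ∷ s) (y ∷ t) o (a ∷ d) =
  OrderIso-maxHead s t o a ∷ OrderIso-decreasing s t (proj₂ o) d

_≪_ : List ℕ → List ℕ → Set
A ≪ B = ∀ {a b} → a ∈ A → b ∈ B → a < b

no-123-in-two-decreasing : ∀ u₁ u₂ {a b c} → u₁ ++ u₂ ≡ a ∷ b ∷ c ∷ [] →
  Decreasing u₁ → Decreasing u₂ → a < b → b < c → ⊥
no-123-in-two-decreasing []                   _ refl _                 ((b<a ∷ _) ∷ _) a<b _   = <-asym a<b b<a
no-123-in-two-decreasing (_ ∷ [])             _ refl _                 ((c<b ∷ _) ∷ _) _   b<c = <-asym b<c c<b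
no-123-in-two-decreasing (_ ∷ _ ∷ [])         _ refl ((b<a ∷ _) ∷ _) _                 a<b _   = <-asym a<b b<a
no-123-in-two-decreasing (_ ∷ _ ∷ _ ∷ [])     _ refl ((b<a ∷ _) ∷ _) _                 a<b _   = <-asym a<b b<a
no-123-in-two-decreasing (_ ∷ _ ∷ _ ∷ _ ∷ _) _ ()   _                 _                 _   _

no-231-in-two-decreasing : ∀ u₁ u₂ {a b c} → u₁ ++ u₂ ≡ a ∷ b ∷ c ∷ [] →
  Decreasing u₁ → Decreasing u₂ → u₁ ≪ u₂ → a < b → c < a → ⊥
no-231-in-two-decreasing []                   _ refl _                 ((b<a ∷ _) ∷ _) _  a<b _   = <-asym a<b b<a
no-231-in-two-decreasing (_ ∷ [])             _ refl _                 _                 ≪  _   c<a =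
  <-asym c<a (≪ (here refl) (there (here refl)))
no-231-in-two-decreasing (_ ∷ _ ∷ [])         _ refl ((b<a ∷ _) ∷ _) _                 _  a<b _   = <-asym a<b b<a
no-231-in-two-decreasing (_ ∷ _ ∷ _ ∷ [])     _ refl ((b<a ∷ _) ∷ _) _                 _  a<b _   = <-asym a<b b<a
no-231-in-two-decreasing (_ ∷ _ ∷ _ ∷ _ ∷ _) _ ()   _                 _                 _  _   _

¬Contains-123-two-decreasing : ∀ A B → Decreasing A → Decreasing B → ¬ Contains (A ++ B) p123
¬Contains-123-two-decreasing A B dA dB (a ∷ b ∷ c ∷ [] , u⊆ , ((a<b , _) ∷ _ ∷ []) , ((b<c , _) ∷ []) , _)
  with ⊆-++-split A {B} u⊆
... | u₁ , u₂ , eq , u₁⊆A , u₂⊆B =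
  no-123-in-two-decreasing u₁ u₂ (sym eq) (AllPairs-resp-⊆ u₁⊆A dA) (AllPairs-resp-⊆ u₂⊆B dB)
    (<ᵇ-true⁻ a<b) (<ᵇ-true⁻ b<c)

¬Contains-231-two-decreasing : ∀ A B → Decreasing A → Decreasing B → A ≪ B → ¬ Contains (A ++ B) p231
¬Contains-231-two-decreasing A B dA dB A≪B (a ∷ b ∷ c ∷ [] , u⊆ , ((a<b , _) ∷ (_ , c<a) ∷ []) , _)
  with ⊆-++-split A {B} u⊆
... | u₁ , u₂ , eq , u₁⊆A , u₂⊆B =
  no-231-in-two-decreasing u₁ u₂ (sym eq) (AllPairs-resp-⊆ u₁⊆A dA) (AllPairs-resp-⊆ u₂⊆B dB)
    (λ a∈ b∈ → A≪B (lookup u₁⊆A a∈) (lookup u₂⊆B b∈)) (<ᵇ-true⁻ a<b) (<ᵇ-true⁻ c<a)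

Contains-maxFirst-two-decreasing : ∀ A B y t → Decreasing A → Decreasing B → A ≪ B → All (_< y) t →
  Contains (A ++ B) (y ∷ t) → Decreasing (y ∷ t)
Contains-maxFirst-two-decreasing A B y t dA dB A≪B t<y (u , u⊆ , o) with ⊆-++-split A {B} u⊆
... | [] , u₂ , refl , _ , u₂⊆B = OrderIso-decreasing u₂ (y ∷ t) o (AllPairs-resp-⊆ u₂⊆B dB)
... | x ∷ u₁ , [] , refl , u₁⊆A , _ =
  OrderIso-decreasing (x ∷ u₁) (y ∷ t) (subst (λ v → OrderIso v (y ∷ t)) (++-identityʳ (x ∷ u₁)) o)
    (AllPairs-resp-⊆ u₁⊆A dA)
... | x ∷ u₁ , b ∷ u₂ , refl , u₁⊆A , u₂⊆B =
  ⊥-elim (<-asym (A≪B (lookup u₁⊆A (here refl)) (lookup u₂⊆B (here refl)))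
                 (All.lookup (OrderIso-maxHead⁻ (u₁ ++ b ∷ u₂) t o t<y) (∈-++⁺ʳ u₁ (here refl))))

¬OrderIso-decreasing-rise : ∀ u p P q Q → Decreasing u → p < q → ¬ OrderIso u (p ∷ P ++ q ∷ Q)
¬OrderIso-decreasing-rise u p P q Q du p<q o with OrderIso-decreasing u _ o du
... | below-p ∷ _ = <-asym p<q (All.lookup below-p (∈-++⁺ʳ P (here refl)))

OrderIso-two-blocks-length : ∀ w u p P q Q → Decreasing w → Decreasing u → All (_< q) (p ∷ P) →
  OrderIso (w ++ u) ((p ∷ P) ++ q ∷ Q) → length w ≡ suc (length P)
OrderIso-two-blocks-length []      u p P q Q _  du (p<q ∷ _) o = ⊥-elim (¬OrderIso-decreasing-rise u p P q Q du p<q o)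
OrderIso-two-blocks-length (x ∷ w) u p P q Q dw du P<q o = cong suc (go x w p P dw P<q o)
  where
  -- The matched heads x and p are kept: if P ends before w, then p < q puts x below the next
  -- entry of w, which is impossible in a decreasing list.
  go : ∀ x w p P → Decreasing (x ∷ w) → All (_< q) (p ∷ P) →
       OrderIso ((x ∷ w) ++ u) ((p ∷ P) ++ q ∷ Q) → length w ≡ length P
  go x []       p []       _                _               _                  = refl
  go x (x' ∷ w) p (p' ∷ P) (_ ∷ dw)         (_ ∷ P<q)       (_ , o)            = cong suc (go x' w p' P dw P<q o)
  go x []       p (p' ∷ P) _                (_ ∷ p'<q ∷ _)  (_ , o)            =
    ⊥-elim (¬OrderIso-decreasing-rise u p' P q Q du p'<q o)
  go x (x' ∷ w) p []       ((x'<x ∷ _) ∷ _) (p<q ∷ _)       (((e , _) ∷ _) , _) =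
    ⊥-elim (<-asym x'<x (<ᵇ-transport (sym e) p<q))

Contains-two-blocks⁻ : ∀ A B p P q Q → Decreasing A → Decreasing B → All (_< q) (p ∷ P) →
  Contains (A ++ B) ((p ∷ P) ++ q ∷ Q) → suc (length P) ≤ length A × suc (length Q) ≤ length B
Contains-two-blocks⁻ A B p P q Q dA dB P<q (u , u⊆ , o) with ⊆-++-split A {B} u⊆
... | w , v , refl , w⊆A , v⊆B = subst (_≤ length A) len-w (length-mono-≤ w⊆A) ,
                                 subst (_≤ length B) len-v (length-mono-≤ v⊆B)
  where
  len-w : length w ≡ suc (length P)
  len-w = OrderIso-two-blocks-length w v p P q Q (AllPairs-resp-⊆ w⊆A dA) (AllPairs-resp-⊆ v⊆B dB) P<q o
  len-v : length v ≡ suc (length Q)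
  len-v = +-cancelˡ-≡ (length w) _ _ (begin
    length w + length v               ≡⟨ length-++ w ⟨
    length (w ++ v)                   ≡⟨ OrderIso⇒length≡ (w ++ v) _ o ⟩
    length ((p ∷ P) ++ q ∷ Q)         ≡⟨ length-++ (p ∷ P) ⟩
    suc (length P) + suc (length Q)   ≡⟨ cong (_+ suc (length Q)) len-w ⟨
    length w + suc (length Q)         ∎)
    where open ≡-Reasoning

length-desc : ∀ lo m → length (desc lo m) ≡ m
length-desc lo zero    = refl
length-desc lo (suc m) = cong suc (length-desc lo m)

∈-desc⁻ : ∀ lo m {v} → v ∈ desc lo m → lo < v × v ≤ lo + m
∈-desc⁻ lo (suc m) (here refl) = m<m+n lo z<s , ≤-refl
∈-desc⁻ lo (suc m) (there v∈) with ∈-desc⁻ lo m v∈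
... | lo<v , v≤ = lo<v , ≤-trans v≤ (+-monoʳ-≤ lo (n≤1+n m))

∈-desc⁺ : ∀ lo m {v} → lo < v → v ≤ lo + m → v ∈ desc lo m
∈-desc⁺ lo zero    lo<v v≤ = ⊥-elim (<⇒≱ lo<v (subst (_ ≤_) (+-identityʳ lo) v≤))
∈-desc⁺ lo (suc m) {v} lo<v v≤ with v ≟ lo + suc m
... | yes refl = here refl
... | no  v≢   = there (∈-desc⁺ lo m lo<v (≤-pred (subst (v <_) (+-suc lo m) (≤∧≢⇒< v≤ v≢))))

desc-decreasing : ∀ lo m → Decreasing (desc lo m)
desc-decreasing lo zero    = []
desc-decreasing lo (suc m) =
  All.tabulate (λ {v} v∈ → subst (v <_) (sym (+-suc lo m)) (s≤s (proj₂ (∈-desc⁻ lo m v∈)))) ∷ desc-decreasing lo m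

desc-≪ : ∀ lo a b → desc lo a ≪ desc (lo + a) b
desc-≪ lo a b u∈ v∈ = ≤-<-trans (proj₂ (∈-desc⁻ lo a u∈)) (proj₁ (∈-desc⁻ (lo + a) b v∈))

desc-+ : ∀ lo a b → desc lo (a + b) ≡ desc (lo + b) a ++ desc lo b
desc-+ lo zero    b = refl
desc-+ lo (suc a) b = cong₂ _∷_ (shift lo a b) (desc-+ lo a b)
  where
  shift : ∀ lo a b → lo + suc (a + b) ≡ lo + b + suc a
  shift = solve-∀

decreasing-length-bound : ∀ w lo hi → lo ≤ hi → Decreasing w → All (lo <_) w → All (_≤ hi) w → length w + lo ≤ hi
decreasing-length-bound []          lo hi lo≤hi _        _          _          = lo≤hi
decreasing-length-bound (suc x ∷ w) lo hi _     (w<x ∷ d) (lo<x ∷ a) (x<hi ∷ _) =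
  ≤-trans (s≤s (decreasing-length-bound w lo x (≤-pred lo<x) d a (All.map ≤-pred w<x))) x<hi

decreasing⇒desc : ∀ m lo w → Decreasing w → All (lo <_) w → All (_≤ lo + m) w → length w ≡ m → w ≡ desc lo m
decreasing⇒desc zero    lo []          _         _          _          _   = refl
decreasing⇒desc (suc m) lo (suc x ∷ w) (w<x ∷ d) (lo<x ∷ a) (x≤ ∷ _) len =
  cong₂ _∷_ x≡ (decreasing⇒desc m lo w d a w≤ m≡)
  where
  m≡ : length w ≡ m
  m≡ = suc-injective len
  x≥ : lo + suc m ≤ suc x
  x≥ = subst (_≤ suc x) (trans (cong (λ l → suc (l + lo)) m≡) (trans (cong suc (+-comm m lo)) (sym (+-suc lo m))))
         (s≤s (decreasing-length-bound w lo x (≤-pred lo<x) d a (All.map ≤-pred w<x)))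
  x≡ : suc x ≡ lo + suc m
  x≡ = ≤-antisym x≤ x≥
  w≤ : All (_≤ lo + m) w
  w≤ = All.map (λ {y} y<x → ≤-pred (subst (suc y ≤_) (trans x≡ (+-suc lo m)) y<x)) w<x

two-decreasing-blocks⇒desc : ∀ m l L R → let L₀ = l ∷ L ; s = length L₀ in
  Decreasing L₀ → Decreasing R → L₀ ≪ R → All (0 <_) L₀ → l ≤ m → All (_≤ m) R → s + length R ≡ m →
  L₀ ≡ desc 0 s × R ≡ desc s (length R)
two-decreasing-blocks⇒desc m l L R L-dec R-dec L≪R L-pos l≤m R≤m s+r≡m = L≡ , R≡
  where
  L₀ = l ∷ L
  s = length L₀
  L≤l : All (_≤ l) L₀
  L≤l = ≤-refl ∷ All.map <⇒≤ (AllPairs.head L-dec)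
  l≡s : l ≡ s
  l≡s = ≤-antisym
    (+-cancelˡ-≤ (length R) l s (subst (length R + l ≤_) (trans (sym s+r≡m) (+-comm s (length R)))
      (decreasing-length-bound R l m l≤m R-dec (All.tabulate (L≪R (here refl))) R≤m)))
    (subst (_≤ l) (+-identityʳ s) (decreasing-length-bound L₀ 0 l z≤n L-dec L-pos L≤l))
  L≡ : L₀ ≡ desc 0 s
  L≡ = decreasing⇒desc s 0 L₀ L-dec L-pos (subst (λ z → All (_≤ z) L₀) l≡s L≤l) refl
  R≡ : R ≡ desc s (length R)
  R≡ = decreasing⇒desc (length R) s R R-dec (All.tabulate (subst (_< _) l≡s ∘ L≪R (here refl)))
         (subst (λ z → All (_≤ z) R) (sym s+r≡m) R≤m) refl

-- Layered permutations

layered : ℕ → ℕ → List ℕ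
layered s t = desc 0 s ++ desc s t

shiftAbove : ℕ → ℕ → ℕ → ℕ
shiftAbove r c v = if r <ᵇ v then v + c else v

shiftAbove-<ᵇ : ∀ r c a b → (shiftAbove r c a <ᵇ shiftAbove r c b) ≡ (a <ᵇ b)
shiftAbove-<ᵇ r c a b with r <ᵇ a in ea | r <ᵇ b in eb
... | true  | true  = <ᵇ-cong (+-cancelʳ-< c a b) (+-monoˡ-< c)
... | false | false = refl
... | true  | false = trans (<ᵇ-false (≤-trans b≤r (<⇒≤ (<-≤-trans r<a (m≤m+n a c)))))
                              (sym (<ᵇ-false (≤-trans b≤r (<⇒≤ r<a))))
  where
  r<a : r < a
  r<a = <ᵇ-true⁻ ea
  b≤r : b ≤ r
  b≤r = <ᵇ-false⁻ eb
... | false | true  = trans (<ᵇ-true (<-≤-trans a<b (m≤m+n b c))) (sym (<ᵇ-true a<b))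
  where
  a<b : a < b
  a<b = ≤-<-trans (<ᵇ-false⁻ ea) (<ᵇ-true⁻ eb)

map-shiftAbove-low : ∀ r c m → m ≤ r → map (shiftAbove r c) (desc 0 m) ≡ desc 0 m
map-shiftAbove-low r c zero    _   = refl
map-shiftAbove-low r c (suc m) m<r with r <ᵇ suc m in e
... | false = cong (suc m ∷_) (map-shiftAbove-low r c m (<⇒≤ m<r))
... | true  = ⊥-elim (<⇒≱ (<ᵇ-true⁻ e) m<r)

map-shiftAbove-high : ∀ r c t → map (shiftAbove r c) (desc r t) ≡ desc (r + c) t
map-shiftAbove-high r c zero    = refl
map-shiftAbove-high r c (suc t) with r <ᵇ r + suc t in e
... | true  = cong₂ _∷_ (shift r c t) (map-shiftAbove-high r c t)
  where
  shift : ∀ r c t → r + suc t + c ≡ r + c + suc t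
  shift = solve-∀
... | false = ⊥-elim (subst T e (<⇒<ᵇ (m<m+n r z<s)))

-- Witness: the r smallest entries of the first layer, then the t largest entries of the second.
Contains-layered⁺ : ∀ r t s u → r ≤ s → t ≤ u → Contains (layered s u) (layered r t)
Contains-layered⁺ r t s u r≤s t≤u with m≤n⇒∃[o]m+o≡n r≤s | m≤n⇒∃[o]m+o≡n t≤u
... | d , refl | e , refl = desc 0 r ++ desc (r + (d + e)) t , ++⁺ low high , iso
  where
  low : desc 0 r ⊆ desc 0 (r + d)
  low = subst (desc 0 r ⊆_) (trans (sym (desc-+ 0 d r)) (cong (desc 0) (+-comm d r))) (++⁺ˡ (desc r d) ⊆-refl)
  high : desc (r + (d + e)) t ⊆ desc (r + d) (t + e)
  high = subst₂ _⊆_ (cong (λ l → desc l t) (+-assoc r d e)) (sym (desc-+ (r + d) t e)) (++⁺ʳ (desc (r + d) e) ⊆-refl)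
  iso : OrderIso (desc 0 r ++ desc (r + (d + e)) t) (layered r t)
  iso = subst (λ v → OrderIso v (layered r t))
          (trans (map-++ (shiftAbove r (d + e)) (desc 0 r) (desc r t))
                 (cong₂ _++_ (map-shiftAbove-low r (d + e) r ≤-refl) (map-shiftAbove-high r (d + e) t)))
          (OrderIso-map (shiftAbove r (d + e)) (shiftAbove-<ᵇ r (d + e)) (layered r t))

Contains-layered⁻ : ∀ r t s u → Contains (layered s u) (layered (suc r) (suc t)) → suc r ≤ s × suc t ≤ u
Contains-layered⁻ r t s u c =
  subst₂ _≤_ (cong suc (length-desc 0 r)) (length-desc 0 s) (proj₁ bounds) ,
  subst₂ _≤_ (cong suc (length-desc (suc r) t)) (length-desc s u) (proj₂ bounds)
  where
  P<q : All (_< suc r + suc t) (desc 0 (suc r))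
  P<q = All.tabulate (λ v∈ → ≤-<-trans (proj₂ (∈-desc⁻ 0 (suc r) v∈)) (m<m+n (suc r) z<s))
  bounds : suc (length (desc 0 r)) ≤ length (desc 0 s) × suc (length (desc (suc r) t)) ≤ length (desc s u)
  bounds = Contains-two-blocks⁻ (desc 0 s) (desc s u) (suc r) (desc 0 r) (suc r + suc t) (desc (suc r) t)
             (desc-decreasing 0 s) (desc-decreasing s u) P<q c

layered-avoids-maxFirst : ∀ s u y t → All (_< y) t → ¬ Decreasing (y ∷ t) → T (avoiding (y ∷ t) (layered s u))
layered-avoids-maxFirst s u y t t<y ¬dec = avoidsᵇ-complete (layered s u) (y ∷ t) (¬dec ∘
  Contains-maxFirst-two-decreasing (desc 0 s) (desc s u) y t (desc-decreasing 0 s) (desc-decreasing s u) (desc-≪ 0 s u) t<y)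

layeredOf : ℕ → ℕ → List ℕ
layeredOf n s = layered s (n ∸ s)

record IsPerm (n : ℕ) (α : List ℕ) : Set where
  field
    length≡ : length α ≡ n
    covers  : ∀ {v} → v ∈ desc 0 n → v ∈ α

  unique : Unique α
  unique = Unique-from-splits α no-dup
    where
    no-dup : ∀ pre x post → α ≡ pre ++ x ∷ post → x ∉ post
    no-dup pre x post refl x∈post = <-irrefl refl (begin-strict
      n                          ≡⟨ length-desc 0 n ⟨
      length (desc 0 n)          ≤⟨ unique⇒length-≤ (desc 0 n) (pre ++ post) desc-unique covers′ ⟩
      length (pre ++ post)       <⟨ n<1+n _ ⟩
      suc (length (pre ++ post)) ≡⟨ cong suc (length-++ pre) ⟩
      suc (length pre + length post) ≡⟨ +-suc (length pre) (length post) ⟨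
      length pre + length (x ∷ post) ≡⟨ length-++ pre ⟨
      length (pre ++ x ∷ post)   ≡⟨ length≡ ⟩
      n                          ∎)
      where
      open ≤-Reasoning
      desc-unique : Unique (desc 0 n)
      desc-unique = Decreasing⇒Unique (desc-decreasing 0 n)
      covers′ : ∀ {v} → v ∈ desc 0 n → v ∈ pre ++ post
      covers′ v∈ with ∈-++⁻ pre (covers v∈)
      ... | inj₁ v∈pre          = ∈-++⁺ˡ v∈pre
      ... | inj₂ (here refl)    = ∈-++⁺ʳ pre x∈post
      ... | inj₂ (there v∈post) = ∈-++⁺ʳ pre v∈post

  bounded : ∀ {v} → v ∈ α → v ∈ desc 0 n
  bounded {v} v∈α with v ∈? desc 0 n
  ... | yes v∈ = v∈
  ... | no  v∉ = ⊥-elim (<-irrefl refl (begin-strict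
      n                       ≡⟨ length-desc 0 n ⟨
      length (desc 0 n)       <⟨ n<1+n _ ⟩
      length (v ∷ desc 0 n)   ≤⟨ unique⇒length-≤ (v ∷ desc 0 n) α v∷desc-unique v∷desc⊆α ⟩
      length α                ≡⟨ length≡ ⟩
      n                       ∎))
    where
    open ≤-Reasoning
    v∷desc⊆α : ∀ {z} → z ∈ v ∷ desc 0 n → z ∈ α
    v∷desc⊆α (here refl) = v∈α
    v∷desc⊆α (there z∈)  = covers z∈
    v∷desc-unique : Unique (v ∷ desc 0 n)
    v∷desc-unique = All.tabulate (λ z∈ v≡z → v∉ (subst (_∈ desc 0 n) (sym v≡z) z∈)) ∷
                      Decreasing⇒Unique (desc-decreasing 0 n)

IsPerm-below : ∀ {n α} → IsPerm n α → All (_< suc n) α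
IsPerm-below perm = All.tabulate (λ v∈ → s≤s (proj₂ (∈-desc⁻ 0 _ (IsPerm.bounded perm v∈))))

decreasing-perm⇒desc : ∀ n α → IsPerm n α → Decreasing α → α ≡ desc 0 n
decreasing-perm⇒desc n α perm dec = decreasing⇒desc n 0 α dec
  (All.tabulate (proj₁ ∘ ∈-desc⁻ 0 n ∘ bounded)) (All.tabulate (proj₂ ∘ ∈-desc⁻ 0 n ∘ bounded)) length≡
  where open IsPerm perm

∈-oneTo⁺ : ∀ n {v} → v ∈ desc 0 n → v ∈ oneTo n
∈-oneTo⁺ n {v} v∈ with ∈-desc⁻ 0 n v∈
∈-oneTo⁺ n {suc i} v∈ | _ , i<n = ∈-map⁺ suc (∈-upTo⁺ i<n)

∈-oneTo⁻ : ∀ n {v} → v ∈ oneTo n → v ∈ desc 0 n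
∈-oneTo⁻ n v∈ with ∈-map⁻ suc v∈
... | i , i∈ , refl = ∈-desc⁺ 0 n z<s (∈-upTo⁻ i∈)

isPermᵇ-sound : ∀ n w → T (isPermᵇ n w) → IsPerm n w
isPermᵇ-sound n w p with Equivalence.to T-∧ p
... | len , cov = record
  { length≡ = ≡ᵇ⇒≡ (length w) n len
  ; covers  = λ {v} v∈ → Any.map (λ x≡ᵇv → sym (≡ᵇ⇒≡ _ v x≡ᵇv))
                (AnyP.any⁻ _ w (All.lookup (AllP.all⁺ _ (oneTo n) cov) (∈-oneTo⁺ n v∈)))
  }

isPermᵇ-complete : ∀ n w → IsPerm n w → T (isPermᵇ n w)
isPermᵇ-complete n w perm = Equivalence.from T-∧
  (≡⇒≡ᵇ (length w) n length≡ ,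
   AllP.all⁻ _ (All.tabulate (λ {v} v∈ →
     AnyP.any⁺ _ (Any.map (λ v≡x → ≡⇒≡ᵇ _ v (sym v≡x)) (covers (∈-oneTo⁻ n v∈))))))
  where open IsPerm perm

∈-words⁺ : ∀ n m w → length w ≡ n → (∀ {v} → v ∈ w → v ∈ desc 0 m) → w ∈ words n m
∈-words⁺ zero    m []      _   _       = here refl
∈-words⁺ (suc n) m (v ∷ w) len bounded =
  ∈-concatMap⁺ (λ w → map (_∷ w) (oneTo m)) (lose (∈-words⁺ n m w (suc-injective len) (bounded ∘ there))
                     (∈-map⁺ (_∷ w) (∈-oneTo⁺ m (bounded (here refl)))))

words-unique : ∀ n m → Unique (words n m)
words-unique zero    m = [] ∷ []
words-unique (suc n) m = UniqueP.concat⁺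
  (AllP.map⁺ (All.tabulate (λ _ → UniqueP.map⁺ (λ eq → proj₁ (∷-injective eq)) oneTo-unique)))
  (AllPairsP.map⁺ (AllPairs.map (λ w≢w' {_} (p , q) → w≢w' (same-tail p q)) (words-unique n m)))
  where
  oneTo-unique : Unique (oneTo m)
  oneTo-unique = UniqueP.map⁺ suc-injective (UniqueP.upTo⁺ m)
  same-tail : ∀ {w w' z} → z ∈ map (_∷ w) (oneTo m) → z ∈ map (_∷ w') (oneTo m) → w ≡ w'
  same-tail p q with ∈-map⁻ (_∷ _) p | ∈-map⁻ (_∷ _) q
  ... | _ , _ , refl | _ , _ , eq = proj₂ (∷-injective eq)

∈-perms⁻ : ∀ n {w} → w ∈ perms n → IsPerm n w
∈-perms⁻ n {w} w∈ = isPermᵇ-sound n w (proj₂ (∈-filter⁻ (T? ∘ isPermᵇ n) {xs = words n n} w∈))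

∈-perms⁺ : ∀ n {w} → IsPerm n w → w ∈ perms n
∈-perms⁺ n {w} perm = ∈-filter⁺ (T? ∘ isPermᵇ n) (∈-words⁺ n n w length≡ bounded) (isPermᵇ-complete n w perm)
  where open IsPerm perm

perms-unique : ∀ n → Unique (perms n)
perms-unique n = UniqueP.filter⁺ (T? ∘ isPermᵇ n) (words-unique n n)

-- The class S_n(123,231)

Avoids123-231 : List ℕ → Set
Avoids123-231 α = ¬ Contains α p123 × ¬ Contains α p231

Avoids123-231-resp-⊆ : ∀ {α β} → α ⊆ β → Avoids123-231 β → Avoids123-231 α
Avoids123-231-resp-⊆ α⊆β (¬123 , ¬231) = ¬123 ∘ Contains-resp-⊆ α⊆β , ¬231 ∘ Contains-resp-⊆ α⊆β

layered-avoids : ∀ s t → Avoids123-231 (layered s t)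
layered-avoids s t =
  ¬Contains-123-two-decreasing (desc 0 s) (desc s t) (desc-decreasing 0 s) (desc-decreasing s t) ,
  ¬Contains-231-two-decreasing (desc 0 s) (desc s t) (desc-decreasing 0 s) (desc-decreasing s t) (desc-≪ 0 s t)

IsPerm-max-split : ∀ m L R → IsPerm (suc m) (L ++ suc m ∷ R) → All (_≤ m) L × All (_≤ m) R
IsPerm-max-split m L R perm =
  All.tabulate (λ x∈ → ≤-pred (≤∧≢⇒< (≤n (∈-++⁺ˡ x∈)) (Unique-pair unique (++⁺ (from∈ x∈) (refl ∷ minimum R))))) ,
  All.tabulate (λ y∈ → ≤-pred (≤∧≢⇒< (≤n (∈-++⁺ʳ L (there y∈)))
                                      (Unique-pair unique (++⁺ (minimum L) (refl ∷ from∈ y∈)) ∘ sym)))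
  where
  open IsPerm perm
  ≤n : ∀ {v} → v ∈ L ++ suc m ∷ R → v ≤ suc m
  ≤n = proj₂ ∘ ∈-desc⁻ 0 (suc m) ∘ bounded

layered-max-inside : ∀ s r → desc 0 s ++ suc (s + r) ∷ desc s r ≡ layered s (suc (s + r) ∸ s)
layered-max-inside s r = cong (desc 0 s ++_) (begin
  suc (s + r) ∷ desc s r       ≡⟨ cong (_∷ desc s r) (+-suc s r) ⟨
  desc s (suc r)               ≡⟨ cong (desc s) (m+n∸m≡n s (suc r)) ⟨
  desc s (s + suc r ∸ s)       ≡⟨ cong (λ n → desc s (n ∸ s)) (+-suc s r) ⟩
  desc s (suc (s + r) ∸ s)     ∎)
  where open ≡-Reasoning

max-inside-blocks : ∀ m l L R → let α = (l ∷ L) ++ suc m ∷ R in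
  IsPerm (suc m) α → Avoids123-231 α → Decreasing (l ∷ L) × Decreasing R × (l ∷ L) ≪ R
max-inside-blocks m l L R perm (¬123 , ¬231) = L-dec , R-dec , L≪R
  where
  open IsPerm perm
  L₀ = l ∷ L
  α = L₀ ++ suc m ∷ R
  L≤m : All (_≤ m) L₀
  L≤m = proj₁ (IsPerm-max-split m L₀ R perm)
  strictly : ∀ {a b} → (a ∷ b ∷ []) ⊆ α → ¬ (a < b) → b < a
  strictly ab⊆ a≮b = ≤∧≢⇒< (≮⇒≥ a≮b) (Unique-pair unique ab⊆ ∘ sym)
  L≪R : L₀ ≪ R
  L≪R x∈ y∈ = ≤∧≢⇒< (≮⇒≥ (λ y<x → ¬231 (Contains-231⁺ (++⁺ (from∈ x∈) (refl ∷ from∈ y∈)) (s≤s (All.lookup L≤m x∈)) y<x)))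
                     (Unique-pair unique (++⁺ (from∈ x∈) (_ ∷ʳ from∈ y∈)))
  L-dec : Decreasing L₀
  L-dec = pairs⇒Decreasing L₀ (λ ab⊆ → strictly (++⁺ ab⊆ (_ ∷ʳ minimum R)) (λ a<b →
    ¬123 (Contains-123⁺ (++⁺ ab⊆ (refl ∷ minimum R)) a<b (s≤s (All.lookup L≤m (lookup ab⊆ (there (here refl))))))))
  R-dec : Decreasing R
  R-dec = pairs⇒Decreasing R (λ ab⊆ → strictly (++⁺ (minimum L₀) (_ ∷ʳ ab⊆)) (λ a<b →
    ¬123 (Contains-123⁺ (++⁺ (from∈ (here refl)) (_ ∷ʳ ab⊆)) (L≪R (here refl) (lookup ab⊆ (here refl))) a<b)))

max-inside⇒layered : ∀ m l L R → let α = (l ∷ L) ++ suc m ∷ R in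
  IsPerm (suc m) α → Avoids123-231 α →
  α ≡ layered (length (l ∷ L)) (suc m ∸ length (l ∷ L)) × length (l ∷ L) ≤ m
max-inside⇒layered m l L R perm avoids = α≡ , s≤m
  where
  open IsPerm perm
  L₀ = l ∷ L
  s = length L₀
  s+r≡m : s + length R ≡ m
  s+r≡m = suc-injective (trans (sym (+-suc s (length R))) (trans (sym (length-++ L₀)) length≡))
  s≤m : s ≤ m
  s≤m = subst (s ≤_) s+r≡m (m≤m+n s (length R))
  blocks : L₀ ≡ desc 0 s × R ≡ desc s (length R)
  blocks with max-inside-blocks m l L R perm avoids | IsPerm-max-split m L₀ R perm
  ... | L-dec , R-dec , L≪R | L≤m , R≤m = two-decreasing-blocks⇒desc m l L R L-dec R-dec L≪R
          (All.tabulate (proj₁ ∘ ∈-desc⁻ 0 (suc m) ∘ bounded ∘ ∈-++⁺ˡ)) (All.head L≤m) R≤m s+r≡m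
  α≡ : L₀ ++ suc m ∷ R ≡ layered s (suc m ∸ s)
  α≡ = begin
    L₀ ++ suc m ∷ R                                    ≡⟨ cong₂ (λ A B → A ++ suc m ∷ B) (proj₁ blocks) (proj₂ blocks) ⟩
    desc 0 s ++ suc m ∷ desc s (length R)              ≡⟨ cong (λ n → desc 0 s ++ suc n ∷ desc s (length R)) s+r≡m ⟨
    desc 0 s ++ suc (s + length R) ∷ desc s (length R) ≡⟨ layered-max-inside s (length R) ⟩
    layered s (suc (s + length R) ∸ s)                 ≡⟨ cong (λ n → layered s (suc n ∸ s)) s+r≡m ⟩
    layered s (suc m ∸ s)                              ∎
    where open ≡-Reasoning

S123-231 : ℕ → List (List ℕ)
S123-231 zero    = [] ∷ []
S123-231 (suc n) = map (suc n ∷_) (S123-231 n) ++ map (layeredOf (suc n)) (desc 0 n)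

∈-S123-231⁻ : ∀ n {α} → α ∈ S123-231 (suc n) →
  (∃ λ α' → α' ∈ S123-231 n × α ≡ suc n ∷ α') ⊎ (∃ λ r → suc r ≤ n × α ≡ layeredOf (suc n) (suc r))
∈-S123-231⁻ n α∈ with ∈-++⁻ (map (suc n ∷_) (S123-231 n)) α∈
... | inj₁ α∈₁ = inj₁ (∈-map⁻ (suc n ∷_) α∈₁)
... | inj₂ α∈₂ with ∈-map⁻ (layeredOf (suc n)) α∈₂
...   | s , s∈ , eq with ∈-desc⁻ 0 n s∈
...     | s≤s _ , s≤n = inj₂ (_ , s≤n , eq)

layeredOf-perm : ∀ n s → s ≤ n → IsPerm n (layeredOf n s)
layeredOf-perm n s s≤n = record
  { length≡ = trans (length-++ (desc 0 s)) (trans (cong₂ _+_ (length-desc 0 s) (length-desc s (n ∸ s))) (m+[n∸m]≡n s≤n))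
  ; covers  = covers
  }
  where
  covers : ∀ {v} → v ∈ desc 0 n → v ∈ layeredOf n s
  covers {v} v∈ with ∈-desc⁻ 0 n v∈ | v ≤? s
  ... | 0<v , _   | yes v≤s = ∈-++⁺ˡ (∈-desc⁺ 0 s 0<v v≤s)
  ... | _   , v≤n | no  v≰s =
    ∈-++⁺ʳ (desc 0 s) (∈-desc⁺ s (n ∸ s) (≰⇒> v≰s) (subst (v ≤_) (sym (m+[n∸m]≡n s≤n)) v≤n))

maxFirst-perm : ∀ n α → IsPerm n α → IsPerm (suc n) (suc n ∷ α)
maxFirst-perm n α perm = record
  { length≡ = cong suc length≡
  ; covers  = λ { (here refl) → here refl ; (there v∈) → there (covers v∈) }
  }
  where open IsPerm perm

maxFirst-avoids : ∀ n α → IsPerm n α → Avoids123-231 α → Avoids123-231 (suc n ∷ α)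
maxFirst-avoids n α perm (¬123 , ¬231) =
  ¬123 ∘ Contains-max∷⁻ (suc n) α 1 (2 ∷ 3 ∷ []) α<n (here refl) (s≤s z<s) ,
  ¬231 ∘ Contains-max∷⁻ (suc n) α 2 (3 ∷ 1 ∷ []) α<n (here refl) (s≤s (s≤s z<s))
  where
  α<n = IsPerm-below perm

S123-231-sound : ∀ n {α} → α ∈ S123-231 n → IsPerm n α × Avoids123-231 α
S123-231-sound zero    (here refl) =
  record { length≡ = refl ; covers = λ () } , ¬Contains-longer [] p123 z<s , ¬Contains-longer [] p231 z<s
S123-231-sound (suc n) α∈ with ∈-S123-231⁻ n α∈
... | inj₁ (α' , α'∈ , refl) with S123-231-sound n α'∈
...   | perm , avoids = maxFirst-perm n α' perm , maxFirst-avoids n α' perm avoids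
S123-231-sound (suc n) α∈ | inj₂ (r , r<n , refl) =
  layeredOf-perm (suc n) (suc r) (m≤n⇒m≤1+n r<n) , layered-avoids (suc r) (suc n ∸ suc r)

S123-231-complete : ∀ n {α} → IsPerm n α → Avoids123-231 α → α ∈ S123-231 n
S123-231-complete zero    {[]} _    _      = here refl
S123-231-complete (suc m)      perm avoids with ∈-∃++ (IsPerm.covers perm (here refl))
... | [] , R , refl =
  ∈-++⁺ˡ (∈-map⁺ (suc m ∷_) (S123-231-complete m R-perm (Avoids123-231-resp-⊆ (_ ∷ʳ ⊆-refl) avoids)))
  where
  open IsPerm perm
  drop-max : ∀ {v} → v ∈ desc 0 m → v ∈ suc m ∷ R → v ∈ R
  drop-max v∈ (here refl) = ⊥-elim (<-irrefl refl (proj₂ (∈-desc⁻ 0 m v∈)))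
  drop-max _  (there v∈R) = v∈R
  R-perm : IsPerm m R
  R-perm = record { length≡ = suc-injective length≡ ; covers = λ v∈ → drop-max v∈ (covers (there v∈)) }
... | l ∷ L , R , refl with max-inside⇒layered m l L R perm avoids
...   | α≡ , s≤m = subst (_∈ S123-231 (suc m)) (sym α≡)
                     (∈-++⁺ʳ (map (suc m ∷_) (S123-231 m)) (∈-map⁺ (layeredOf (suc m)) (∈-desc⁺ 0 m z<s s≤m)))

heads-of-layered : ∀ n m → map (head ∘ layeredOf n) (desc 0 m) ≡ map just (desc 0 m)
heads-of-layered n zero    = refl
heads-of-layered n (suc m) = cong (just (suc m) ∷_) (heads-of-layered n m)

S123-231-unique : ∀ n → Unique (S123-231 n)
S123-231-unique zero    = [] ∷ []
S123-231-unique (suc m) =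
  UniqueP.++⁺ (UniqueP.map⁺ (proj₂ ∘ ∷-injective) (S123-231-unique m)) layered-unique disjoint
  where
  layered-unique : Unique (map (layeredOf (suc m)) (desc 0 m))
  layered-unique = UniqueP.map⁻ {f = head}
    (subst Unique (sym (trans (sym (map-∘ (desc 0 m))) (heads-of-layered (suc m) m)))
      (UniqueP.map⁺ just-injective (Decreasing⇒Unique (desc-decreasing 0 m))))
  disjoint : ∀ {α} → ¬ (α ∈ map (suc m ∷_) (S123-231 m) × α ∈ map (layeredOf (suc m)) (desc 0 m))
  disjoint (p , q) with ∈-map⁻ (suc m ∷_) p | ∈-map⁻ (layeredOf (suc m)) q
  ... | _ , _ , refl | s , s∈ , eq with ∈-desc⁻ 0 m s∈
  ...   | s≤s _ , s≤m = <-irrefl (sym (proj₁ (∷-injective eq))) (s≤s s≤m)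

S123-231⇒InS123-231 : ∀ n {α} → α ∈ S123-231 n → InS123-231 n α
S123-231⇒InS123-231 n {α} α∈ with S123-231-sound n α∈
... | perm , ¬123 , ¬231 = isPermᵇ-complete n α perm , avoidsᵇ-complete α p123 ¬123 , avoidsᵇ-complete α p231 ¬231

InS123-231⇒S123-231 : ∀ n {α} → InS123-231 n α → α ∈ S123-231 n
InS123-231⇒S123-231 n {α} (perm , av123 , av231) =
  S123-231-complete n (isPermᵇ-sound n α perm) (avoidsᵇ-sound α p123 av123 , avoidsᵇ-sound α p231 av231)

-- Counting

b≡count : ∀ τ n → b τ n ≡ count (avoiding τ) (S123-231 n)
b≡count τ n = unique-same-members⇒length≡ _ _
  (UniqueP.filter⁺ (T? ∘ avoids-all) (perms-unique n)) (UniqueP.filter⁺ (T? ∘ avoiding τ) (S123-231-unique n))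
  to from
  where
  avoids-all : List ℕ → Bool
  avoids-all α = avoidsᵇ α p123 ∧ avoidsᵇ α p231 ∧ avoidsᵇ α τ
  to : ∀ {α} → α ∈ filterᵇ avoids-all (perms n) → α ∈ filterᵇ (avoiding τ) (S123-231 n)
  to {α} α∈ with ∈-filter⁻ (T? ∘ avoids-all) {xs = perms n} α∈
  ... | α∈perms , av with Equivalence.to T-∧ av
  ...   | av123 , av231-τ with Equivalence.to T-∧ av231-τ
  ...     | av231 , avτ = ∈-filter⁺ (T? ∘ avoiding τ)
            (S123-231-complete n (∈-perms⁻ n α∈perms) (avoidsᵇ-sound α p123 av123 , avoidsᵇ-sound α p231 av231)) avτ
  from : ∀ {α} → α ∈ filterᵇ (avoiding τ) (S123-231 n) → α ∈ filterᵇ avoids-all (perms n)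
  from {α} α∈ with ∈-filter⁻ (T? ∘ avoiding τ) {xs = S123-231 n} α∈
  ... | α∈S , avτ with S123-231-sound n α∈S
  ...   | perm , ¬123 , ¬231 = ∈-filter⁺ (T? ∘ avoids-all) (∈-perms⁺ n perm)
            (Equivalence.from T-∧ (avoidsᵇ-complete α p123 ¬123 ,
                                   Equivalence.from T-∧ (avoidsᵇ-complete α p231 ¬231 , avτ)))

count-S123-231-suc : ∀ (p : List ℕ → Bool) m →
  count p (S123-231 (suc m)) ≡ count (p ∘ (suc m ∷_)) (S123-231 m) + count (p ∘ layeredOf (suc m)) (desc 0 m)
count-S123-231-suc p m = trans (count-++ p (map (suc m ∷_) (S123-231 m)) _)
  (cong₂ _+_ (count-map p (suc m ∷_) (S123-231 m)) (count-map p (layeredOf (suc m)) (desc 0 m)))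

length-S123-231-suc : ∀ m → length (S123-231 (suc m)) ≡ length (S123-231 m) + m
length-S123-231-suc m = trans (length-++ (map (suc m ∷_) (S123-231 m)))
  (cong₂ _+_ (length-map (suc m ∷_) (S123-231 m)) (trans (length-map (layeredOf (suc m)) (desc 0 m)) (length-desc 0 m)))

b-maxFirst-recurrence : ∀ j τ' → IsPerm j τ' → suc j ∷ τ' ≢ desc 0 (suc j) →
                        ∀ m → b (suc j ∷ τ') (suc m) ≡ b τ' m + m
b-maxFirst-recurrence j τ' perm τ≢desc m = begin
  b τ (suc m)                                                   ≡⟨ b≡count τ (suc m) ⟩
  count (avoiding τ) (S123-231 (suc m))                          ≡⟨ count-S123-231-suc (avoiding τ) m ⟩
  count (avoiding τ ∘ (suc m ∷_)) (S123-231 m) +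
    count (avoiding τ ∘ layeredOf (suc m)) (desc 0 m)            ≡⟨ cong₂ _+_ max-first layered-part ⟩
  count (avoiding τ') (S123-231 m) + m                           ≡⟨ cong (_+ m) (b≡count τ' m) ⟨
  b τ' m + m                                                     ∎
  where
  open ≡-Reasoning
  τ = suc j ∷ τ'
  max-first : count (avoiding τ ∘ (suc m ∷_)) (S123-231 m) ≡ count (avoiding τ') (S123-231 m)
  max-first = count-cong _ (avoiding τ') (S123-231 m) (λ {α} α∈ →
    avoidsᵇ-cong (suc m ∷ α) τ α τ' (Contains-∷⁻ (suc m) α (suc j) τ')
      (Contains-∷⁺ (suc m) α (suc j) τ' (IsPerm-below (proj₁ (S123-231-sound m α∈))) (IsPerm-below perm)))
  layered-part : count (avoiding τ ∘ layeredOf (suc m)) (desc 0 m) ≡ m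
  layered-part = trans
    (count-all (avoiding τ ∘ layeredOf (suc m)) {desc 0 m} (All.tabulate (λ {s} _ →
      layered-avoids-maxFirst s (suc m ∸ s) (suc j) τ' (IsPerm-below perm)
        (τ≢desc ∘ decreasing-perm⇒desc (suc j) τ (maxFirst-perm j τ' perm)))))
    (length-desc 0 m)

-- Twice the closed form (k - 2) n - k (k - 3) / 2, so that no division is needed.
closedForm : ℕ → ℕ → ℤ
closedForm k n = + 2 * ((+ k - + 2) * + n) - + k * (+ k - + 3)

closedForm-suc : ∀ q n → closedForm (2 + q) (suc n) ≡ closedForm (2 + q) n ℤ.+ + 2 * + q
closedForm-suc q n = identity (+ q) (+ n)
  where
  identity : ∀ Q N → + 2 * ((+ 2 ℤ.+ Q - + 2) * (+ 1 ℤ.+ N)) - (+ 2 ℤ.+ Q) * (+ 2 ℤ.+ Q - + 3)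
                     ≡ (+ 2 * ((+ 2 ℤ.+ Q - + 2) * N) - (+ 2 ℤ.+ Q) * (+ 2 ℤ.+ Q - + 3)) ℤ.+ + 2 * Q
  identity = ℤ.solve-∀

closedForm-diagonal : ∀ q → closedForm (2 + q) (suc q) ≡ + suc q * + suc q - + suc q ℤ.+ + 2
closedForm-diagonal q = identity (+ q)
  where
  identity : ∀ Q → + 2 * ((+ 2 ℤ.+ Q - + 2) * (+ 1 ℤ.+ Q)) - (+ 2 ℤ.+ Q) * (+ 2 ℤ.+ Q - + 3)
                   ≡ (+ 1 ℤ.+ Q) * (+ 1 ℤ.+ Q) - (+ 1 ℤ.+ Q) ℤ.+ + 2
  identity = ℤ.solve-∀

length-S123-231 : ∀ n → + 2 * + length (S123-231 n) ≡ + n * + n - + n ℤ.+ + 2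
length-S123-231 zero    = refl
length-S123-231 (suc n) = begin
  + 2 * + length (S123-231 (suc n))                 ≡⟨ cong (λ l → + 2 * + l) (length-S123-231-suc n) ⟩
  + 2 * (+ length (S123-231 n) ℤ.+ + n)             ≡⟨ ℤ.*-distribˡ-+ (+ 2) (+ length (S123-231 n)) (+ n) ⟩
  + 2 * + length (S123-231 n) ℤ.+ + 2 * + n         ≡⟨ cong (ℤ._+ + 2 * + n) (length-S123-231 n) ⟩
  (+ n * + n - + n ℤ.+ + 2) ℤ.+ + 2 * + n           ≡⟨ identity (+ n) ⟩
  + suc n * + suc n - + suc n ℤ.+ + 2               ∎
  where
  open ≡-Reasoning
  identity : ∀ N → (N * N - N ℤ.+ + 2) ℤ.+ + 2 * N ≡ (+ 1 ℤ.+ N) * (+ 1 ℤ.+ N) - (+ 1 ℤ.+ N) ℤ.+ + 2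
  identity = ℤ.solve-∀

recurrence⇒closedForm : ∀ (c : ℕ → ℕ) q j → + 2 * + c j ≡ closedForm (2 + q) j →
  (∀ e → c (suc (j + e)) ≡ c (j + e) + q) → ∀ e → + 2 * + c (j + e) ≡ closedForm (2 + q) (j + e)
recurrence⇒closedForm c q j base step zero    =
  subst (λ n → + 2 * + c n ≡ closedForm (2 + q) n) (sym (+-identityʳ j)) base
recurrence⇒closedForm c q j base step (suc e) =
  subst (λ n → + 2 * + c n ≡ closedForm (2 + q) n) (sym (+-suc j e)) (begin
    + 2 * + c (suc (j + e))                   ≡⟨ cong (λ x → + 2 * + x) (step e) ⟩
    + 2 * (+ c (j + e) ℤ.+ + q)               ≡⟨ ℤ.*-distribˡ-+ (+ 2) (+ c (j + e)) (+ q) ⟩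
    + 2 * + c (j + e) ℤ.+ + 2 * + q           ≡⟨ cong (ℤ._+ + 2 * + q) (recurrence⇒closedForm c q j base step e) ⟩
    closedForm (2 + q) (j + e) ℤ.+ + 2 * + q  ≡⟨ closedForm-suc q (j + e) ⟨
    closedForm (2 + q) (suc (j + e))          ∎)
  where open ≡-Reasoning

module _ (r t : ℕ) where

  private
    τ₀ = layered (suc r) (suc t)

  layeredOf-avoids-low : ∀ n s → s ≤ r → T (avoiding τ₀ (layeredOf n s))
  layeredOf-avoids-low n s s≤r = avoidsᵇ-complete _ τ₀ (λ c →
    <⇒≱ (s≤s s≤r) (proj₁ (Contains-layered⁻ r t s (n ∸ s) c)))

  layeredOf-avoids-high : ∀ n s → s ≤ n → n < suc t + s → T (avoiding τ₀ (layeredOf n s))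
  layeredOf-avoids-high n s s≤n n< = avoidsᵇ-complete _ τ₀ (λ c →
    <⇒≱ n< (m≤o∸n⇒m+n≤o (suc t) s≤n (proj₂ (Contains-layered⁻ r t s (n ∸ s) c))))

  layeredOf-contains-middle : ∀ n s → suc r ≤ s → suc t + s ≤ n → ¬ T (avoiding τ₀ (layeredOf n s))
  layeredOf-contains-middle n s r<s ≤n av =
    avoidsᵇ-sound _ τ₀ av (Contains-layered⁺ (suc r) (suc t) s (n ∸ s) r<s (m+n≤o⇒m≤o∸n (suc t) ≤n))

  high-range-avoids : ∀ e {s} → s ∈ desc (suc e + r) t → T (avoiding τ₀ (layeredOf (suc (suc (r + t + e))) s))
  high-range-avoids e {s} s∈ with ∈-desc⁻ (suc e + r) t s∈
  ... | lo< , ≤hi = layeredOf-avoids-high _ s (m≤n⇒m≤1+n (≤-trans ≤hi (≤-reflexive (hi≡ r t e))))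
                      (≤-trans (≤-reflexive (n≡ r t e)) (+-monoʳ-≤ (suc t) lo<))
    where
    hi≡ : ∀ r t e → suc e + r + t ≡ suc (r + t + e)
    hi≡ = solve-∀
    n≡ : ∀ r t e → suc (suc (suc (r + t + e))) ≡ suc t + suc (suc e + r)
    n≡ = solve-∀

  middle-range-contains : ∀ e {s} → s ∈ desc r (suc e) → ¬ T (avoiding τ₀ (layeredOf (suc (suc (r + t + e))) s))
  middle-range-contains e {s} s∈ with ∈-desc⁻ r (suc e) s∈
  ... | r< , ≤r+e = layeredOf-contains-middle _ s r< (≤-trans (+-monoʳ-≤ (suc t) ≤r+e) (≤-reflexive (n≡ r t e)))
    where
    n≡ : ∀ r t e → suc t + (r + suc e) ≡ suc (suc (r + t + e))
    n≡ = solve-∀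

  -- With m = r + t + e + 1, the range 1, ..., m splits as high ++ middle ++ low, and
  -- layeredOf (m+1) s contains τ₀ exactly for s in the middle range r < s ≤ r + 1 + e.
  count-layered-avoiders : ∀ e → let m = suc (r + t + e) in count (avoiding τ₀ ∘ layeredOf (suc m)) (desc 0 m) ≡ r + t
  count-layered-avoiders e = begin
    count P (desc 0 m)                            ≡⟨ cong (count P) split ⟩
    count P (high ++ middle ++ low)               ≡⟨ count-++ P high (middle ++ low) ⟩
    count P high + count P (middle ++ low)        ≡⟨ cong (_+_ (count P high)) (count-++ P middle low) ⟩
    count P high + (count P middle + count P low) ≡⟨ cong₂ _+_ high-count (cong₂ _+_ middle-count low-count) ⟩
    t + (0 + r)                                   ≡⟨ +-comm t r ⟩
    r + t                                         ∎
    where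
    open ≡-Reasoning
    m = suc (r + t + e)
    P = avoiding τ₀ ∘ layeredOf (suc m)
    high middle low : List ℕ
    high   = desc (suc e + r) t
    middle = desc r (suc e)
    low    = desc 0 r
    m≡ : ∀ r t e → suc (r + t + e) ≡ t + (suc e + r)
    m≡ = solve-∀
    split : desc 0 m ≡ high ++ middle ++ low
    split = trans (cong (desc 0) (m≡ r t e)) (trans (desc-+ 0 t (suc e + r)) (cong (high ++_) (desc-+ 0 (suc e) r)))
    high-count : count P high ≡ t
    high-count = trans (count-all P (All.tabulate (high-range-avoids e))) (length-desc (suc e + r) t)
    middle-count : count P middle ≡ 0
    middle-count = count-none P (All.tabulate (middle-range-contains e))
    low-count : count P low ≡ r
    low-count = trans (count-all P (All.tabulate (layeredOf-avoids-low (suc m) _ ∘ proj₂ ∘ ∈-desc⁻ 0 r)))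
                      (length-desc 0 r)

  count-layered-step : ∀ e → let m = suc (r + t + e) in
    count (avoiding τ₀) (S123-231 (suc m)) ≡ count (avoiding τ₀) (S123-231 m) + (r + t)
  count-layered-step e = trans (count-S123-231-suc (avoiding τ₀) m) (cong₂ _+_ max-first-avoids (count-layered-avoiders e))
    where
    m = suc (r + t + e)
    max-first-avoids : count (avoiding τ₀ ∘ (suc m ∷_)) (S123-231 m) ≡ count (avoiding τ₀) (S123-231 m)
    max-first-avoids = count-cong _ (avoiding τ₀) (S123-231 m) (λ {α} α∈ → avoidsᵇ-cong (suc m ∷ α) τ₀ α τ₀
      (Contains-max∷⁻ (suc m) α (suc r) (desc 0 r ++ desc (suc r) (suc t)) (IsPerm-below (proj₁ (S123-231-sound m α∈)))
        (∈-++⁺ʳ (desc 0 r) (here refl)) (m<m+n (suc r) z<s))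
      (Contains-resp-⊆ (suc m ∷ʳ ⊆-refl)))

  count-layered-base : count (avoiding τ₀) (S123-231 (suc (r + t))) ≡ length (S123-231 (suc (r + t)))
  count-layered-base = count-all (avoiding τ₀) (All.tabulate (λ {α} α∈ →
    avoidsᵇ-complete α τ₀ (¬Contains-longer α τ₀ (shorter α∈))))
    where
    length-τ₀ : length τ₀ ≡ suc (suc (r + t))
    length-τ₀ = trans (length-++ (desc 0 (suc r)))
      (trans (cong₂ _+_ (length-desc 0 (suc r)) (length-desc (suc r) (suc t))) (cong suc (+-suc r t)))
    shorter : ∀ {α} → α ∈ S123-231 (suc (r + t)) → length α < length τ₀
    shorter α∈ = subst₂ _<_ (sym (IsPerm.length≡ (proj₁ (S123-231-sound _ α∈)))) (sym length-τ₀) ≤-refl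

  b-layered-closedForm : ∀ n → suc (suc (r + t)) ≤ n → + 2 * + b τ₀ n ≡ closedForm (suc (suc (r + t))) n
  b-layered-closedForm n k≤n with m≤n⇒∃[o]m+o≡n (≤-trans (n≤1+n _) k≤n)
  ... | e , refl = begin
    + 2 * + b τ₀ (suc (r + t) + e)          ≡⟨ cong (λ x → + 2 * + x) (b≡count τ₀ (suc (r + t) + e)) ⟩
    + 2 * + C (suc (r + t) + e)              ≡⟨ recurrence⇒closedForm C (r + t) (suc (r + t)) base count-layered-step e ⟩
    closedForm (suc (suc (r + t))) (suc (r + t) + e) ∎
    where
    open ≡-Reasoning
    C : ℕ → ℕ
    C n = count (avoiding τ₀) (S123-231 n)
    base : + 2 * + C (suc (r + t)) ≡ closedForm (2 + (r + t)) (suc (r + t))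
    base = trans (cong (λ x → + 2 * + x) count-layered-base)
                 (trans (length-S123-231 (suc (r + t))) (sym (closedForm-diagonal (r + t))))

lemma2 : (k : ℕ) → 1 ≤ k → (τ : List ℕ) → InS123-231 k τ → τ ≢ desc 0 k →
    (Σ ℕ (λ r → 1 ≤ r × r ≤ k ∸ 1 × τ ≡ desc 0 r ++ desc r (k ∸ r) ×
        ((n : ℕ) → k ≤ n →
          (+ 2) * (+ b τ n) ≡ (+ 2) * ((+ k - + 2) * + n) - (+ k) * (+ k - + 3))))
    ⊎
    (Σ (List ℕ) (λ τ' → InS123-231 (k ∸ 1) τ' × τ ≡ k ∷ τ' ×
        ((n : ℕ) → k ≤ n → b τ n ≡ b τ' (n ∸ 1) + (n ∸ 1))))
lemma2 (suc j) _ τ τ∈ τ≢desc with ∈-S123-231⁻ j (InS123-231⇒S123-231 (suc j) {τ} τ∈)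
... | inj₁ (τ' , τ'∈ , refl) = inj₂ (τ' , S123-231⇒InS123-231 j τ'∈ , refl , recurrence)
  where
  recurrence : ∀ n → suc j ≤ n → b τ n ≡ b τ' (n ∸ 1) + (n ∸ 1)
  recurrence (suc m) _ = b-maxFirst-recurrence j τ' (proj₁ (S123-231-sound j τ'∈)) τ≢desc m
... | inj₂ (r , r<j , refl) with m≤n⇒∃[o]m+o≡n r<j
...   | t , refl = inj₁ (suc r , s≤s z≤n , r<j , refl , λ n k≤n →
          subst (λ σ → + 2 * + b σ n ≡ closedForm (suc (suc (r + t))) n) (sym τ≡) (b-layered-closedForm r t n k≤n))
  where
  τ≡ : τ ≡ layered (suc r) (suc t)
  τ≡ = cong (layered (suc r)) (trans (cong (_∸ r) (sym (+-suc r t))) (m+n∸m≡n r (suc t)))
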